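{- Let $G$ be a simple graph with vertex set $[d]$, $d\ge1$, let $R$ and $K_G$ be as in the context, and let $T_G(n)=n^d-\chi_G(n)$ be the tail of the chromatic polynomial of $G$. Then $$\frac1t\sum_{n\ge0}T_G(n)t^n=\frac{h(R/K_G,t)}{(1-t)^d},$$ where $h(R/K_G,t)$ denotes the numerator of the Hilbert series of $R/K_G$ written over the denominator $(1-t)^d$, i.e. $h(R/K_G,t)=(1-t)^dF(R/K_G,t)$ with $F(R/K_G,t)=\sum_{n\ge0}\dim_{\mathbb k}(R/K_G)_nt^n$. Thus, up to a shift by one, the $W$-transform of $T_G$ equals the polynomial whose coefficients are the coordinates of the $h$-vector of the coloring complex of $G$.
   Context: $G$ is a simple graph with vertex set $[d]$; $\chi_G(m)$ is the number of maps $\phi:[d]\to[m]$ with $\phi(x)\neq\phi(y)$ for adjacent $x,y$. The $W$-transform of a polynomial $P$ of degree $\delta$ is the polynomial $W$ with $\sum_{n\ge0}P(n)t^n=W(t)/(1-t)^{\delta+1}$. For $\pi=a_1\cdots a_d\in\mathcal S_d$ and $k\in[d]$, $\ell(k)$ is the largest $r\ge0$ such that there are indices $i_0<\cdots<i_r=k$ with $a_{i_{s-1}}$ adjacent to $a_{i_s}$ for all $s$. An integer $k\in\{0,\dots,d-1\}$ is a cut of $\pi$ if $k=0$, or $\ell(k)<\ell(k+1)$, or $\ell(k)=\ell(k+1)$ and $a_k<a_{k+1}$. If the cuts are $0=i_1<\cdots<i_q$, the $G$-sequence of $\pi$ is $S_1,\dots,S_q$ with $S_j=\{a_{i_j+1},\dots,a_{i_{j+1}}\}$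 for $j<q$ and $S_q=\{a_{i_q+1},\dots,a_d\}$; the short $G$-sequence is $S_1,\dots,S_{q-1}$. Let $\mathbb k$ be a field, $A=\mathbb k[x_S:S\subseteq[d]]$ graded with each $x_S$ of degree $1$, $I$ the ideal generated by all $x_Sx_T$ with $S,T$ incomparable, and $R=A/I$ (face ring of the order complex of the Boolean algebra of all subsets of $[d]$). A basic coloring monomial is $x_{S_1}\cdots x_{S_k}$ ($k\ge0$) with $\emptyset\subsetneq S_1\subsetneq\cdots\subsetneq S_k\subsetneq[d]$ such that some $\pi$ has short $G$-sequence $S_1,S_2\setminus S_1,\dots,S_k\setminus S_{k-1}$; the coloring ideal $K_G\subseteq R$ is generated by these (squarefree) monomials. The coloring complex of $G$ is the simplicial complex whose face ring is $R/K_G$: its vertices are subsets of $[d]$, and its faces are the chains of subsets of $[d]$ containing no chain $\{S_1,\dots,S_k\}$ coming from a basic coloring monomial. Its $h$-vector is the coefficient sequence of the numerator of the Hilbert series of its face ring written over $(1-t)^{\dim+1}$. -}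

module Defs where

open import Data.Bool using (Bool; true; false; _∧_; _∨_; not; if_then_else_)
open import Data.Nat using (ℕ; zero; suc; _^_; _<ᵇ_; _≡ᵇ_; _∸_; _⊔_)
open import Data.Fin using (Fin; toℕ)
open import Data.Vec using (Vec; []; _∷_; lookup; toList)
open import Data.List using (List; []; _∷_; [_]; map; concatMap; length; foldr; reverse; allFin; zip)
open import Data.Fin.Subset using (Subset; ⊥; _∪_; ⁅_⁆)
open import Data.Integer using (ℤ; +_; _-_)
open import Data.Product using (_×_; _,_; proj₁; proj₂)
open import Relation.Binary.PropositionalEquality using (_≡_)

record SimpleGraph (d : ℕ) : Set where
  field
    adj    : Fin d → Fin d → Bool
    sym    : ∀ x y → adj x y ≡ adj y x
    irrefl : ∀ x → adj x x ≡ false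
open SimpleGraph public

countB : {A : Set} → (A → Bool) → List A → ℕ
countB p [] = 0
countB p (x ∷ xs) = if p x then suc (countB p xs) else countB p xs

filterB : {A : Set} → (A → Bool) → List A → List A
filterB p [] = []
filterB p (x ∷ xs) = if p x then x ∷ filterB p xs else filterB p xs

allB : {A : Set} → (A → Bool) → List A → Bool
allB p [] = true
allB p (x ∷ xs) = p x ∧ allB p xs

anyB : {A : Set} → (A → Bool) → List A → Bool
anyB p [] = false
anyB p (x ∷ xs) = p x ∨ anyB p xs

allVecs : {A : Set} → List A → (n : ℕ) → List (Vec A n)
allVecs xs zero = [ [] ]
allVecs xs (suc n) = concatMap (λ x → map (x ∷_) (allVecs xs n)) xs

finEq : {d : ℕ} → Fin d → Fin d → Bool
finEq x y = toℕ x ≡ᵇ toℕ y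

-- Chromatic polynomial: χ_G(m) = number of proper maps [d] → [m]
-- (maps φ : Fin d → Fin m encoded as Vec (Fin m) d)

properB : {d m : ℕ} → SimpleGraph d → Vec (Fin m) d → Bool
properB {d} G φ =
  allB (λ x → allB (λ y → not (adj G x y) ∨ not (finEq (lookup φ x) (lookup φ y)))
                   (allFin d))
       (allFin d)

chromatic : {d : ℕ} → SimpleGraph d → ℕ → ℕ
chromatic {d} G m = countB (properB G) (allVecs (allFin m) d)

tailChrom : {d : ℕ} → SimpleGraph d → ℕ → ℤ
tailChrom {d} G n = + (n ^ d) - + (chromatic G n)

-- Permutations π = a_1 ⋯ a_d ∈ S_d, encoded as injective Vec (Fin d) d

injectiveB : {d : ℕ} → Vec (Fin d) d → Bool
injectiveB {d} π =
  allB (λ i → allB (λ j → finEq i j ∨ not (finEq (lookup π i) (lookup π j)))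
                   (allFin d))
       (allFin d)

perms : (d : ℕ) → List (Vec (Fin d) d)
perms d = filterB injectiveB (allVecs (allFin d) d)

-- ℓ(k): largest r such that there are positions i_0 < ⋯ < i_r = k with
-- a_{i_{s-1}} adjacent to a_{i_s}.  Chains of positions are enumerated as
-- subsets of positions (listed in increasing order).

lastIs : {d : ℕ} → List (Fin d) → Fin d → Bool
lastIs [] k = false
lastIs (x ∷ []) k = finEq x k
lastIs (x ∷ y ∷ xs) k = lastIs (y ∷ xs) k

consecAdj : {d : ℕ} → (Fin d → Fin d → Bool) → List (Fin d) → Bool
consecAdj r [] = true
consecAdj r (x ∷ []) = true
consecAdj r (x ∷ y ∷ xs) = r x y ∧ consecAdj r (y ∷ xs)

positions : {d : ℕ} → Vec Bool d → List (Fin d)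
positions {d} s = filterB (lookup s) (allFin d)

ell : {d : ℕ} → SimpleGraph d → Vec (Fin d) d → Fin d → ℕ
ell {d} G π k =
  foldr _⊔_ 0
    (map (λ s → length (positions s) ∸ 1)
      (filterB (λ s → lastIs (positions s) k
                      ∧ consecAdj (λ i j → adj G (lookup π i) (lookup π j)) (positions s))
               (allVecs (true ∷ false ∷ []) d)))

-- A boundary between consecutive positions k, k+1 (1-based,
-- k ≥ 1) is a cut iff ℓ(k) < ℓ(k+1), or ℓ(k) = ℓ(k+1) and a_k < a_{k+1};
-- position 0 is always a cut (the first block starts at a_1).

cutB : {d : ℕ} → (Fin d × ℕ) → (Fin d × ℕ) → Bool
cutB (a , l) (a' , l') = (l <ᵇ l') ∨ ((l ≡ᵇ l') ∧ (toℕ a <ᵇ toℕ a'))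

blocks : {d : ℕ} → List (Fin d × ℕ) → List (List (Fin d))
blocks [] = []
blocks (x ∷ []) = [ proj₁ x ∷ [] ]
blocks (x ∷ y ∷ rest) with blocks (y ∷ rest)
... | [] = [ proj₁ x ∷ [] ]
... | b ∷ bs = if cutB x y then (proj₁ x ∷ []) ∷ b ∷ bs else (proj₁ x ∷ b) ∷ bs

gSequence : {d : ℕ} → SimpleGraph d → Vec (Fin d) d → List (List (Fin d))
gSequence {d} G π = blocks (zip (toList π) (map (ell G π) (allFin d)))

dropLast : {A : Set} → List A → List A
dropLast [] = []
dropLast (x ∷ []) = []
dropLast (x ∷ y ∷ xs) = x ∷ dropLast (y ∷ xs)

shortGSequence : {d : ℕ} → SimpleGraph d → Vec (Fin d) d → List (List (Fin d))
shortGSequence G π = dropLast (gSequence G π)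

toSubset : {d : ℕ} → List (Fin d) → Subset d
toSubset [] = ⊥
toSubset (x ∷ xs) = ⁅ x ⁆ ∪ toSubset xs

prefixUnions : {d : ℕ} → Subset d → List (List (Fin d)) → List (Subset d)
prefixUnions acc [] = []
prefixUnions acc (b ∷ bs) = (acc ∪ toSubset b) ∷ prefixUnions (acc ∪ toSubset b) bs

-- the chain S_1 ⊊ ⋯ ⊊ S_k of the basic coloring monomial x_{S_1}⋯x_{S_k}
-- associated with π (short G-sequence S_1, S_2∖S_1, …, S_k∖S_{k-1})
basicColoringChain : {d : ℕ} → SimpleGraph d → Vec (Fin d) d → List (Subset d)
basicColoringChain G π = prefixUnions ⊥ (shortGSequence G π)

subsetEq : {d : ℕ} → Subset d → Subset d → Bool
subsetEq [] [] = true
subsetEq (x ∷ xs) (y ∷ ys) = ((x ∧ y) ∨ (not x ∧ not y)) ∧ subsetEq xs ys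

subsetLeq : {d : ℕ} → Subset d → Subset d → Bool
subsetLeq [] [] = true
subsetLeq (x ∷ xs) (y ∷ ys) = (not x ∨ y) ∧ subsetLeq xs ys

comparableB : {d : ℕ} → Subset d → Subset d → Bool
comparableB S T = subsetLeq S T ∨ subsetLeq T S

-- a fixed total (lexicographic) order on variables, false < true
lexLeq : {d : ℕ} → Subset d → Subset d → Bool
lexLeq [] [] = true
lexLeq (x ∷ xs) (y ∷ ys) = (not x ∧ y) ∨ (((x ∧ y) ∨ (not x ∧ not y)) ∧ lexLeq xs ys)

allSubsets : (d : ℕ) → List (Subset d)
allSubsets d = allVecs (true ∷ false ∷ []) d

-- Monomials of degree n in A = k[x_S : S ⊆ [d]]: multisets of n variables,
-- encoded as vectors of variables sorted w.r.t. lexLeq.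

sortedB : {d n : ℕ} → Vec (Subset d) n → Bool
sortedB [] = true
sortedB (S ∷ []) = true
sortedB (S ∷ T ∷ m) = lexLeq S T ∧ sortedB (T ∷ m)

monomials : (d n : ℕ) → List (Vec (Subset d) n)
monomials d n = filterB sortedB (allVecs (allSubsets d) n)

occurs : {d n : ℕ} → Subset d → Vec (Subset d) n → Bool
occurs S m = anyB (subsetEq S) (toList m)

-- m lies in I: divisible by some x_S x_T with S, T incomparable
inI : {d n : ℕ} → Vec (Subset d) n → Bool
inI m = anyB (λ S → anyB (λ T → not (comparableB S T)) (toList m)) (toList m)

-- m lies in (the preimage in A of) K_G: divisible by some basic coloring monomial
inKG : {d n : ℕ} → SimpleGraph d → Vec (Subset d) n → Bool
inKG {d} G m = anyB (λ π → allB (λ S → occurs S m) (basicColoringChain G π)) (perms d)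

-- dim_k (R/K_G)_n = dim_k (A/(I + K_G))_n : the number of degree-n monomials
-- outside the monomial ideal I + K_G (these form a k-basis of the quotient)
hilbertFn : {d : ℕ} → SimpleGraph d → ℕ → ℕ
hilbertFn {d} G n = countB (λ m → not (inI m) ∧ not (inKG G m)) (monomials d n)

{-# OPTIONS --safe #-}
module Submission where

-- A monomial of degree n outside I is a multichain S₁ ⊆ ⋯ ⊆ Sₙ of subsets of [d], and such
-- multichains correspond bijectively to maps f : [d] → {0, …, n} through S_{i+1} = f⁻¹{0, …, i}.
-- The multichain of f lies in K_G exactly when f is a proper colouring.
--   If the basic colouring monomial of π divides it and a_i a_j (i < j) is an edge, either some
--   cut lies between positions i and j, and the prefix set at that cut is a level set of f
--   containing a_i but not a_j, or ℓ does not increase from i to j, against ℓ(i) < ℓ(j).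
--   Conversely, for proper f list the vertices by colour, and inside a colour class so that no
--   two consecutive vertices form a cut. Then ℓ(k) is the length of a longest colour-increasing
--   path ending at a_k, cuts only occur where the colour jumps, and every prefix set at a cut
--   is a level set of f.
-- Hence dim (R/K_G)_n counts the improper maps [d] → [n+1], that is (n+1)^d − χ_G(n+1).

open import Defs hiding (sym)

open import Data.Bool using (Bool; true; false; T; not; _∧_; _∨_; if_then_else_)
open import Data.Bool.Properties using (T-∧; T-∨; T-≡; T-not-≡)
open import Data.Bool.ListAction using (all; any)
open import Data.Nat
  using (ℕ; zero; suc; _+_; _*_; _^_; _∸_; _⊔_; _≤_; _<_; z≤n; s≤s; s≤s⁻¹; z<s; s<s; s<s⁻¹
        ; _≤ᵇ_; _<ᵇ_; _≡ᵇ_)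
open import Data.Nat.Properties
  using ( +-suc; +-identityʳ; m+n∸m≡n; m+[n∸m]≡n; suc-injective; m≤m+n; n≤1+n; 1+n≰n
        ; ≤-refl; ≤-reflexive; ≤-trans; ≤-antisym; ≤-total
        ; <⇒≤; <⇒≱; ≮⇒≥; ≰⇒>; ≤∧≢⇒<
        ; <-irrefl; <-asym; ≤-<-trans; <-≤-trans; <-cmp; ⊔-sel; m⊔n≤o⇒m≤o; m⊔n≤o⇒n≤o
        ; ≡ᵇ⇒≡; ≡⇒≡ᵇ; ≤ᵇ⇒≤; ≤⇒≤ᵇ; <ᵇ⇒<; <⇒<ᵇ )
open import Data.Integer using (+_; _-_; _⊖_)
open import Data.Integer.Properties using (m-n≡m⊖n; ⊖-≥)
open import Data.Fin using (Fin; zero; suc; toℕ; punchOut; fromℕ<) renaming (_<_ to _<ᶠ_; _≤_ to _≤ᶠ_)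
open import Data.Fin.Properties
  using (toℕ-injective; toℕ-fromℕ<; toℕ<n; any?; punchOut-injective; injective⇒≤)
  renaming (_≟_ to _≟ᶠ_; <-cmp to <-cmpᶠ)
open import Data.Fin.Subset using (Subset; _⊆_; _∪_; ⁅_⁆) renaming (_∈_ to _∈ₛ_; ⊥ to ∅)
open import Data.Fin.Subset.Properties
  using ( drop-∷-⊆; ⊆-antisym; ⊆-reflexive; ⊆-trans; p⊆p∪q
        ; x∈p∪q⁺; x∈p∪q⁻; x∈⁅x⁆; x∈⁅y⁆⇒x≡y; ∉⊥; ∪-assoc; ∪-identityʳ )
open import Data.Product using (_×_; _,_; ∃-syntax; proj₁; proj₂)
open import Data.Sum as Sum using (_⊎_; inj₁; inj₂; [_,_]′)
import Data.List as List
open import Data.List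
  using (List; []; _∷_; [_]; _++_; map; foldr; length; allFin; filterᵇ; concatMap; cartesianProductWith; zip)
open import Data.List.Properties
  using (length-++; length-++-comm; length-map; length-tabulate; map-tabulate; foldr-forcesᵇ)
open import Data.List.Membership.Propositional using (_∈_; find; lose)
open import Data.List.Membership.Propositional.Properties
  using (∈-filter⁺; ∈-filter⁻; ∈-map⁺; ∈-map⁻; ∈-cartesianProductWith⁺; foldr-selective; ∈-allFin)
open import Data.List.Membership.Propositional.Properties.WithK using (unique∧set⇒bag)
open import Data.List.Relation.Binary.Subset.Propositional using () renaming (_⊆_ to _⊆ₗ_)
open import Data.List.Relation.Binary.BagAndSetEquality using (∼bag⇒↭)
open import Data.List.Relation.Binary.Permutation.Propositional
  using (_↭_; ↭-refl; ↭-prep; ↭-swap; ↭-trans; ↭-sym; ↭⇒↭ₛ)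
open import Data.List.Relation.Binary.Permutation.Propositional.Properties using (↭-length; ∈-resp-↭)
import Data.List.Relation.Binary.Permutation.Setoid.Properties as Permutationₛ
open import Data.List.Relation.Unary.All as All using (All)
open import Data.List.Relation.Unary.All.Properties using (all⁺; all⁻)
open import Data.List.Relation.Unary.Any as Any using (Any; here; there)
open import Data.List.Relation.Unary.Any.Properties using (any⁺; any⁻; singleton⁻)
open import Data.List.Relation.Unary.AllPairs using ([]; _∷_)
open import Data.List.Relation.Unary.Linked as Linked using (Linked; []; [-]; _∷_)
open import Data.List.Relation.Unary.Linked.Properties
  using () renaming (map⁺ to Linked-map⁺; map⁻ to Linked-map⁻)
open import Data.List.Relation.Unary.Unique.Propositional using (Unique)
import Data.List.Relation.Unary.Unique.Propositional.Properties as Unique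
open import Data.Vec as Vec using (Vec; []; _∷_; lookup; tabulate; toList)
open import Data.Vec.Properties
  using (∷-injective; []=↔lookup; lookup∘tabulate; tabulate∘lookup; tabulate-cong)
open import Data.Vec.Membership.Propositional.Properties using (∈-toList⁺; ∈-toList⁻; ∈-lookup)
import Data.Vec.Relation.Unary.Any as Anyᵥ
open import Data.Vec.Relation.Unary.Any.Properties using (lookup-index)
open import Function using (_∘_; flip)
open import Function.Bundles using (Equivalence; Inverse; _⇔_; mk⇔)
open import Function.Definitions using (Injective)
open import Relation.Nullary using (¬_; contradiction; Dec; yes; no)
open import Relation.Nullary.Decidable using (T?)
open import Relation.Binary.Definitions using (tri<; tri≈; tri>)
open import Relation.Binary.PropositionalEquality hiding ([_])

T-not⇔¬T : ∀ {b} → T (not b) ⇔ (¬ T b)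
T-not⇔¬T {true}  = mk⇔ (λ ()) (λ ¬t → ¬t _)
T-not⇔¬T {false} = mk⇔ (λ _ ()) _

T-not-∨⇔ : ∀ {a b} → T (not a ∨ b) ⇔ (T a → T b)
T-not-∨⇔ {true}  = mk⇔ (λ b _ → b) (λ a⇒b → a⇒b _)
T-not-∨⇔ {false} = mk⇔ (λ _ ()) _

T-∨-not⇔ : ∀ {a b} → T (b ∨ not a) ⇔ (T a → T b)
T-∨-not⇔ {b = true}  = mk⇔ _ _
T-∨-not⇔ {b = false} = T-not⇔¬T

finEq⇔≡ : ∀ {d} (x y : Fin d) → T (finEq x y) ⇔ x ≡ y
finEq⇔≡ x y = mk⇔
  (toℕ-injective ∘ ≡ᵇ⇒≡ (toℕ x) (toℕ y))
  (≡⇒≡ᵇ (toℕ x) (toℕ y) ∘ cong toℕ)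

module _ {A : Set} (p : A → Bool) where

  filterB≡filterᵇ : ∀ xs → filterB p xs ≡ filterᵇ p xs
  filterB≡filterᵇ [] = refl
  filterB≡filterᵇ (x ∷ xs) with p x
  ... | true  = cong (x ∷_) (filterB≡filterᵇ xs)
  ... | false = filterB≡filterᵇ xs

  countB≡length-filterᵇ : ∀ xs → countB p xs ≡ length (filterᵇ p xs)
  countB≡length-filterᵇ [] = refl
  countB≡length-filterᵇ (x ∷ xs) with p x
  ... | true  = cong suc (countB≡length-filterᵇ xs)
  ... | false = countB≡length-filterᵇ xs

  countB+countB-not : ∀ xs → countB p xs + countB (not ∘ p) xs ≡ length xs
  countB+countB-not [] = refl
  countB+countB-not (x ∷ xs) with p x
  ... | true  = cong suc (countB+countB-not xs)
  ... | false = trans (+-suc _ _) (cong suc (countB+countB-not xs))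

  ∈-filterB⁺ : ∀ {x xs} → x ∈ xs → T (p x) → x ∈ filterB p xs
  ∈-filterB⁺ {xs = xs} x∈xs px =
    subst (_ ∈_) (sym (filterB≡filterᵇ xs)) (∈-filter⁺ (T? ∘ p) x∈xs px)

  ∈-filterB⁻ : ∀ xs {x} → x ∈ filterB p xs → x ∈ xs × T (p x)
  ∈-filterB⁻ xs = ∈-filter⁻ (T? ∘ p) ∘ subst (_ ∈_) (filterB≡filterᵇ xs)

  filterB-unique : ∀ {xs} → Unique xs → Unique (filterB p xs)
  filterB-unique {xs} = subst Unique (sym (filterB≡filterᵇ xs)) ∘ Unique.filter⁺ (T? ∘ p)

  filterB-map : ∀ {B : Set} (g : B → A) xs → filterB p (map g xs) ≡ map g (filterB (p ∘ g) xs)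
  filterB-map g [] = refl
  filterB-map g (x ∷ xs) with p (g x)
  ... | true  = cong (g x ∷_) (filterB-map g xs)
  ... | false = filterB-map g xs

  allB≡all : ∀ xs → allB p xs ≡ all p xs
  allB≡all [] = refl
  allB≡all (x ∷ xs) = cong (p x ∧_) (allB≡all xs)

  anyB≡any : ∀ xs → anyB p xs ≡ any p xs
  anyB≡any [] = refl
  anyB≡any (x ∷ xs) = cong (p x ∨_) (anyB≡any xs)

  allB⇒All : ∀ xs → T (allB p xs) → All (T ∘ p) xs
  allB⇒All xs = all⁺ p xs ∘ subst T (allB≡all xs)

  All⇒allB : ∀ {xs} → All (T ∘ p) xs → T (allB p xs)
  All⇒allB {xs} = subst T (sym (allB≡all xs)) ∘ all⁻ p

  anyB⇒Any : ∀ xs → T (anyB p xs) → Any (T ∘ p) xs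
  anyB⇒Any xs = any⁻ p xs ∘ subst T (anyB≡any xs)

  Any⇒anyB : ∀ {xs} → Any (T ∘ p) xs → T (anyB p xs)
  Any⇒anyB {xs} = subst T (sym (anyB≡any xs)) ∘ any⁺ p


allB-allFin⇔ : ∀ {d} (p : Fin d → Bool) → T (allB p (allFin d)) ⇔ (∀ x → T (p x))
allB-allFin⇔ {d} p = mk⇔
  (λ h x → All.lookup (allB⇒All p (allFin d) h) (∈-allFin x))
  (λ h → All⇒allB p {allFin d} (All.tabulate (λ {x} _ → h x)))

allB²-allFin⇔ : ∀ {d} (p : Fin d → Fin d → Bool) →
  T (allB (λ x → allB (p x) (allFin d)) (allFin d)) ⇔ (∀ x y → T (p x y))
allB²-allFin⇔ {d} p = mk⇔
  (λ h x y → Equivalence.to (allB-allFin⇔ (p x)) (Equivalence.to (allB-allFin⇔ row) h x) y)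
  (λ h → Equivalence.from (allB-allFin⇔ row) (λ x → Equivalence.from (allB-allFin⇔ (p x)) (h x)))
  where
  row : Fin d → Bool
  row x = allB (p x) (allFin d)

≤-foldr-⊔ : ∀ {x} xs → x ∈ xs → x ≤ foldr _⊔_ 0 xs
≤-foldr-⊔ xs = All.lookup (foldr-forcesᵇ ⊔-bounded 0 xs ≤-refl)
  where
  ⊔-bounded : ∀ x y → x ⊔ y ≤ foldr _⊔_ 0 xs → x ≤ foldr _⊔_ 0 xs × y ≤ foldr _⊔_ 0 xs
  ⊔-bounded x y h = m⊔n≤o⇒m≤o x y h , m⊔n≤o⇒n≤o x y h

countB-bijection : {A B : Set} (p : A → Bool) (q : B → Bool) {xs : List A} {ys : List B} →
  Unique xs → Unique ys → (h : B → A) → Injective _≡_ _≡_ h →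
  (∀ {y} → y ∈ ys → T (q y) → h y ∈ xs × T (p (h y))) →
  (∀ {x} → x ∈ xs → T (p x) → ∃[ y ] y ∈ ys × T (q y) × h y ≡ x) →
  countB q ys ≡ countB p xs
countB-bijection p q {xs} {ys} xs! ys! h h-inj forth back = begin
  countB q ys                    ≡⟨ countB≡length-filterᵇ q ys ⟩
  length (filterᵇ q ys)          ≡⟨ length-map h (filterᵇ q ys) ⟨
  length (map h (filterᵇ q ys))  ≡⟨ ↭-length (∼bag⇒↭ (unique∧set⇒bag hqys! pxs! sameElements)) ⟩
  length (filterᵇ p xs)          ≡⟨ countB≡length-filterᵇ p xs ⟨
  countB p xs                    ∎
  where
  open ≡-Reasoning
  hqys! : Unique (map h (filterᵇ q ys))
  hqys! = Unique.map⁺ h-inj (Unique.filter⁺ (T? ∘ q) ys!)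
  pxs! : Unique (filterᵇ p xs)
  pxs! = Unique.filter⁺ (T? ∘ p) xs!
  sameElements : ∀ {x} → (x ∈ map h (filterᵇ q ys)) ⇔ (x ∈ filterᵇ p xs)
  sameElements = mk⇔ to from
    where
    to : ∀ {x} → x ∈ map h (filterᵇ q ys) → x ∈ filterᵇ p xs
    to x∈ with y , y∈ , refl ← ∈-map⁻ h x∈ with y∈ys , qy ← ∈-filter⁻ (T? ∘ q) y∈ =
      let hy∈xs , phy = forth y∈ys qy in ∈-filter⁺ (T? ∘ p) hy∈xs phy
    from : ∀ {x} → x ∈ filterᵇ p xs → x ∈ map h (filterᵇ q ys)
    from x∈ with x∈xs , px ← ∈-filter⁻ (T? ∘ p) x∈ with y , y∈ys , qy , refl ← back x∈xs px =
      ∈-map⁺ h (∈-filter⁺ (T? ∘ q) y∈ys qy)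

module _ {A B C : Set} (f : A → B → C) where

  concatMap-map≡cartesianProductWith : ∀ xs ys →
    concatMap (λ x → map (f x) ys) xs ≡ cartesianProductWith f xs ys
  concatMap-map≡cartesianProductWith [] ys = refl
  concatMap-map≡cartesianProductWith (x ∷ xs) ys =
    cong (map (f x) ys ++_) (concatMap-map≡cartesianProductWith xs ys)

  length-cartesianProductWith : ∀ xs ys → length (cartesianProductWith f xs ys) ≡ length xs * length ys
  length-cartesianProductWith [] ys = refl
  length-cartesianProductWith (x ∷ xs) ys = begin
    length (map (f x) ys ++ cartesianProductWith f xs ys)  ≡⟨ length-++ (map (f x) ys) ⟩
    length (map (f x) ys) + length (cartesianProductWith f xs ys)
      ≡⟨ cong₂ _+_ (length-map (f x) ys) (length-cartesianProductWith xs ys) ⟩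
    length ys + length xs * length ys  ∎
    where open ≡-Reasoning

module _ {A : Set} (xs : List A) where

  allVecs-suc : ∀ n → allVecs xs (suc n) ≡ cartesianProductWith _∷_ xs (allVecs xs n)
  allVecs-suc n = concatMap-map≡cartesianProductWith _∷_ xs (allVecs xs n)

  ∈-allVecs : (∀ x → x ∈ xs) → ∀ {n} (v : Vec A n) → v ∈ allVecs xs n
  ∈-allVecs every [] = Any.here refl
  ∈-allVecs every {suc n} (x ∷ v) =
    subst (_ ∈_) (sym (allVecs-suc n)) (∈-cartesianProductWith⁺ _∷_ (every x) (∈-allVecs every v))

  allVecs-unique : Unique xs → ∀ n → Unique (allVecs xs n)
  allVecs-unique xs! zero = All.[] ∷ []
  allVecs-unique xs! (suc n) =
    subst Unique (sym (allVecs-suc n)) (Unique.cartesianProductWith⁺ _∷_ ∷-injective xs! (allVecs-unique xs! n))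

  length-allVecs : ∀ n → length (allVecs xs n) ≡ length xs ^ n
  length-allVecs zero = refl
  length-allVecs (suc n) = begin
    length (allVecs xs (suc n))                          ≡⟨ cong length (allVecs-suc n) ⟩
    length (cartesianProductWith _∷_ xs (allVecs xs n))  ≡⟨ length-cartesianProductWith _∷_ xs _ ⟩
    length xs * length (allVecs xs n)                    ≡⟨ cong (length xs *_) (length-allVecs n) ⟩
    length xs * length xs ^ n                            ∎
    where open ≡-Reasoning

every-bool : ∀ b → b ∈ true ∷ false ∷ []
every-bool true = here refl
every-bool false = there (here refl)

booleans-unique : Unique (true ∷ false ∷ [])
booleans-unique = ((λ ()) All.∷ All.[]) ∷ All.[] ∷ []

every-subset : ∀ {d} (S : Subset d) → S ∈ allSubsets d
every-subset = ∈-allVecs (true ∷ false ∷ []) every-bool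

_⋖_ : ∀ {m} → Fin m → Fin m → Set
i ⋖ j = toℕ j ≡ suc (toℕ i)

zip-toList-map-allFin : ∀ {A B : Set} {d} (v : Vec A d) (g : Fin d → B) →
  zip (toList v) (map g (allFin d)) ≡ List.tabulate (λ k → lookup v k , g k)
zip-toList-map-allFin [] g = refl
zip-toList-map-allFin (a ∷ v) g = cong ((a , g zero) ∷_) (begin
  zip (toList v) (map g (List.tabulate suc))  ≡⟨ cong (zip (toList v)) (map-tabulate suc g) ⟩
  zip (toList v) (List.tabulate (g ∘ suc))    ≡⟨ cong (zip (toList v)) (map-tabulate (λ i → i) (g ∘ suc)) ⟨
  zip (toList v) (map (g ∘ suc) (allFin _))   ≡⟨ zip-toList-map-allFin v (g ∘ suc) ⟩
  List.tabulate (λ k → lookup v k , g (suc k)) ∎)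
  where open ≡-Reasoning

module _ {A : Set} where

  toList-tabulate : ∀ {n} (g : Fin n → A) → toList (tabulate g) ≡ List.tabulate g
  toList-tabulate {zero} g = refl
  toList-tabulate {suc n} g = cong (g zero ∷_) (toList-tabulate (g ∘ suc))

  lookup-injective : ∀ {n} (v : Vec A n) → Unique (toList v) → Injective _≡_ _≡_ (lookup v)
  lookup-injective (x ∷ v) (x∉v ∷ v!) {zero} {zero} _ = refl
  lookup-injective (x ∷ v) (x∉v ∷ v!) {zero} {suc j} x≡vj =
    contradiction x≡vj (All.lookup x∉v (∈-toList⁺ (∈-lookup j v)))
  lookup-injective (x ∷ v) (x∉v ∷ v!) {suc i} {zero} vi≡x =
    contradiction (sym vi≡x) (All.lookup x∉v (∈-toList⁺ (∈-lookup i v)))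
  lookup-injective (x ∷ v) (x∉v ∷ v!) {suc i} {suc j} vi≡vj = cong suc (lookup-injective v v! vi≡vj)

  ∈-toList⇒lookup : ∀ {n} (v : Vec A n) {x} → x ∈ toList v → ∃[ i ] lookup v i ≡ x
  ∈-toList⇒lookup v x∈ = let x∈v = ∈-toList⁻ x∈ in Anyᵥ.index x∈v , sym (lookup-index x∈v)

  module _ {R : A → A → Set} where

    Linked-lookup-⋖ : ∀ {n} (v : Vec A n) → Linked R (toList v) →
      ∀ {k k′} → k ⋖ k′ → R (lookup v k) (lookup v k′)
    Linked-lookup-⋖ (x ∷ y ∷ v) (Rxy ∷ _) {zero} {suc zero} _ = Rxy
    Linked-lookup-⋖ (x ∷ v) linked {suc k} {suc k′} k⋖k′ =
      Linked-lookup-⋖ v (Linked.tail linked) (suc-injective k⋖k′)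

    Linked-lookup-mono : (g : A → ℕ) → (∀ {a b} → R a b → g a ≤ g b) →
      ∀ {n} (v : Vec A n) → Linked R (toList v) → ∀ {i j} → i ≤ᶠ j → g (lookup v i) ≤ g (lookup v j)
    Linked-lookup-mono g g-mono (x ∷ v) linked {zero} {zero} _ = ≤-refl
    Linked-lookup-mono g g-mono (x ∷ y ∷ v) (Rxy ∷ linked) {zero} {suc j} _ =
      ≤-trans (g-mono Rxy) (Linked-lookup-mono g g-mono (y ∷ v) linked {zero} {j} z≤n)
    Linked-lookup-mono g g-mono (x ∷ v) linked {suc i} {suc j} (s≤s i≤j) =
      Linked-lookup-mono g g-mono v (Linked.tail linked) i≤j

injective⇒surjective : ∀ {d} (f : Fin d → Fin d) → Injective _≡_ _≡_ f → ∀ y → ∃[ x ] f x ≡ y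
injective⇒surjective {suc d} f f-inj y with any? (λ x → f x ≟ᶠ y)
... | yes found = found
... | no missing = contradiction (injective⇒≤ g-inj) 1+n≰n
  where
  y≢f : ∀ x → y ≢ f x
  y≢f x y≡fx = missing (x , sym y≡fx)
  g : Fin (suc d) → Fin d
  g x = punchOut (y≢f x)
  g-inj : Injective _≡_ _≡_ g
  g-inj {x} {x′} = f-inj ∘ punchOut-injective (y≢f x) (y≢f x′)

module InsertionSort {A : Set} (_≼_ : A → A → Bool) (≼-total : ∀ x y → ¬ T (x ≼ y) → T (y ≼ x))
  where

  insert : ∀ {n} → A → Vec A n → Vec A (suc n)
  insert x [] = x ∷ []
  insert x (y ∷ ys) with T? (x ≼ y)
  ... | yes _ = x ∷ y ∷ ys
  ... | no _  = y ∷ insert x ys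

  sort : ∀ {n} → Vec A n → Vec A n
  sort [] = []
  sort (x ∷ xs) = insert x (sort xs)

  Sorted : ∀ {n} → Vec A n → Set
  Sorted v = Linked (λ x y → T (x ≼ y)) (toList v)

  private
    insert-sorted-below : ∀ {n} z x (v : Vec A n) → T (z ≼ x) →
      Sorted (z ∷ v) → Sorted (z ∷ insert x v)
    insert-sorted-below z x [] z≼x _ = z≼x ∷ [-]
    insert-sorted-below z x (y ∷ ys) z≼x (z≼y ∷ sorted) with T? (x ≼ y)
    ... | yes x≼y = z≼x ∷ x≼y ∷ sorted
    ... | no x⋠y  = z≼y ∷ insert-sorted-below y x ys (≼-total x y x⋠y) sorted

  insert-sorted : ∀ {n} x (v : Vec A n) → Sorted v → Sorted (insert x v)
  insert-sorted x [] _ = [-]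
  insert-sorted x (y ∷ ys) sorted with T? (x ≼ y)
  ... | yes x≼y = x≼y ∷ sorted
  ... | no x⋠y  = insert-sorted-below y x ys (≼-total x y x⋠y) sorted

  sort-sorted : ∀ {n} (v : Vec A n) → Sorted (sort v)
  sort-sorted [] = []
  sort-sorted (x ∷ v) = insert-sorted x (sort v) (sort-sorted v)

  insert-↭ : ∀ {n} x (v : Vec A n) → toList (insert x v) ↭ x ∷ toList v
  insert-↭ x [] = ↭-refl
  insert-↭ x (y ∷ ys) with T? (x ≼ y)
  ... | yes _ = ↭-refl
  ... | no _  = ↭-trans (↭-prep y (insert-↭ x ys)) (↭-swap y x ↭-refl)

  sort-↭ : ∀ {n} (v : Vec A n) → toList (sort v) ↭ toList v
  sort-↭ [] = ↭-refl
  sort-↭ (x ∷ v) = ↭-trans (insert-↭ x (sort v)) (↭-prep x (sort-↭ v))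

∈ₛ⇔lookup : ∀ {d} {x : Fin d} {p : Subset d} → x ∈ₛ p ⇔ lookup p x ≡ true
∈ₛ⇔lookup = mk⇔ (Inverse.to []=↔lookup) (Inverse.from []=↔lookup)

∈ₛ-tabulate⇔ : ∀ {d} {x : Fin d} (g : Fin d → Bool) → x ∈ₛ tabulate g ⇔ T (g x)
∈ₛ-tabulate⇔ {x = x} g = mk⇔
  (Equivalence.from T-≡ ∘ trans (sym (lookup∘tabulate g x)) ∘ Equivalence.to ∈ₛ⇔lookup)
  (Equivalence.from ∈ₛ⇔lookup ∘ trans (lookup∘tabulate g x) ∘ Equivalence.to T-≡)

∈ₛ-toSubset⇔ : ∀ {d} {x : Fin d} (l : List (Fin d)) → x ∈ₛ toSubset l ⇔ x ∈ l
∈ₛ-toSubset⇔ l = mk⇔ (to l) (from l)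
  where
  to : ∀ {x} l → x ∈ₛ toSubset l → x ∈ l
  to [] x∈∅ = contradiction x∈∅ ∉⊥
  to (y ∷ l) x∈ = [ here ∘ x∈⁅y⁆⇒x≡y y , there ∘ to l ]′ (x∈p∪q⁻ ⁅ y ⁆ (toSubset l) x∈)
  from : ∀ {x} l → x ∈ l → x ∈ₛ toSubset l
  from (y ∷ l) (here refl) = x∈p∪q⁺ (inj₁ (x∈⁅x⁆ y))
  from (y ∷ l) (there x∈l) = x∈p∪q⁺ (inj₂ (from l x∈l))

subsetEq⇒≡ : ∀ {d} (p q : Subset d) → T (subsetEq p q) → p ≡ q
subsetEq⇒≡ [] [] _ = refl
subsetEq⇒≡ (true ∷ p) (true ∷ q) h = cong (true ∷_) (subsetEq⇒≡ p q h)
subsetEq⇒≡ (false ∷ p) (false ∷ q) h = cong (false ∷_) (subsetEq⇒≡ p q h)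

subsetEq-refl : ∀ {d} (p : Subset d) → T (subsetEq p p)
subsetEq-refl [] = _
subsetEq-refl (true ∷ p) = subsetEq-refl p
subsetEq-refl (false ∷ p) = subsetEq-refl p

subsetLeq⇒⊆ : ∀ {d} (p q : Subset d) → T (subsetLeq p q) → p ⊆ q
subsetLeq⇒⊆ (true ∷ p) (true ∷ q) h Vec.here = Vec.here
subsetLeq⇒⊆ (true ∷ p) (true ∷ q) h (Vec.there x∈p) = Vec.there (subsetLeq⇒⊆ p q h x∈p)
subsetLeq⇒⊆ (false ∷ p) (b ∷ q) h (Vec.there x∈p) = Vec.there (subsetLeq⇒⊆ p q h x∈p)

⊆⇒subsetLeq : ∀ {d} (p q : Subset d) → p ⊆ q → T (subsetLeq p q)
⊆⇒subsetLeq [] [] _ = _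
⊆⇒subsetLeq (true ∷ p) (true ∷ q) p⊆q = ⊆⇒subsetLeq p q (drop-∷-⊆ p⊆q)
⊆⇒subsetLeq (true ∷ p) (false ∷ q) p⊆q with () ← p⊆q Vec.here
⊆⇒subsetLeq (false ∷ p) (b ∷ q) p⊆q = ⊆⇒subsetLeq p q (drop-∷-⊆ p⊆q)

comparableB⇔ : ∀ {d} (p q : Subset d) → T (comparableB p q) ⇔ (p ⊆ q ⊎ q ⊆ p)
comparableB⇔ p q = mk⇔
  (Sum.map (subsetLeq⇒⊆ p q) (subsetLeq⇒⊆ q p) ∘ Equivalence.to T-∨)
  (Equivalence.from T-∨ ∘ Sum.map (⊆⇒subsetLeq p q) (⊆⇒subsetLeq q p))

⊆⇒lexLeq : ∀ {d} (p q : Subset d) → p ⊆ q → T (lexLeq p q)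
⊆⇒lexLeq [] [] _ = _
⊆⇒lexLeq (true ∷ p) (true ∷ q) p⊆q = ⊆⇒lexLeq p q (drop-∷-⊆ p⊆q)
⊆⇒lexLeq (true ∷ p) (false ∷ q) p⊆q with () ← p⊆q Vec.here
⊆⇒lexLeq (false ∷ p) (true ∷ q) p⊆q = _
⊆⇒lexLeq (false ∷ p) (false ∷ q) p⊆q = ⊆⇒lexLeq p q (drop-∷-⊆ p⊆q)

lexLeq-antisym : ∀ {d} (p q : Subset d) → T (lexLeq p q) → q ⊆ p → p ≡ q
lexLeq-antisym [] [] _ _ = refl
lexLeq-antisym (true ∷ p) (true ∷ q) h q⊆p = cong (true ∷_) (lexLeq-antisym p q h (drop-∷-⊆ q⊆p))
lexLeq-antisym (false ∷ p) (true ∷ q) h q⊆p with () ← q⊆p Vec.here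
lexLeq-antisym (false ∷ p) (false ∷ q) h q⊆p = cong (false ∷_) (lexLeq-antisym p q h (drop-∷-⊆ q⊆p))

occurs⇔∈ : ∀ {d n} {S : Subset d} (m : Vec (Subset d) n) → T (occurs S m) ⇔ S ∈ toList m
occurs⇔∈ {S = S} m = mk⇔ to from
  where
  to : T (occurs S m) → S ∈ toList m
  to h with U , U∈m , S≐U ← find (anyB⇒Any (subsetEq S) (toList m) h) =
    subst (_∈ toList m) (sym (subsetEq⇒≡ S U S≐U)) U∈m
  from : S ∈ toList m → T (occurs S m)
  from S∈m = Any⇒anyB (subsetEq S) (Any.map (λ { refl → subsetEq-refl S }) S∈m)

predFin : ∀ {n} → Fin (suc (suc n)) → Fin (suc n)
predFin zero = zero
predFin (suc i) = i

module _ {d n : ℕ} where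

  level : (Fin d → Fin (suc n)) → ℕ → Subset d
  level f i = tabulate (λ x → toℕ (f x) ≤ᵇ i)

  ∈-level⇔ : ∀ f {i x} → x ∈ₛ level f i ⇔ toℕ (f x) ≤ i
  ∈-level⇔ f {i} {x} = mk⇔
    (≤ᵇ⇒≤ (toℕ (f x)) i ∘ Equivalence.to (∈ₛ-tabulate⇔ _))
    (Equivalence.from (∈ₛ-tabulate⇔ _) ∘ ≤⇒≤ᵇ)

  level-mono : ∀ f {i j} → i ≤ j → level f i ⊆ level f j
  level-mono f i≤j = Equivalence.from (∈-level⇔ f) ∘ flip ≤-trans i≤j ∘ Equivalence.to (∈-level⇔ f)

  level-cong : ∀ {f g} → (∀ x → f x ≡ g x) → ∀ i → level f i ≡ level g i
  level-cong f≗g i = tabulate-cong (λ x → cong (λ y → toℕ y ≤ᵇ i) (f≗g x))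

level-predFin : ∀ {d n} (f : Fin d → Fin (suc (suc n))) i → level (predFin ∘ f) i ≡ level f (suc i)
level-predFin f i = tabulate-cong (λ x → shift (f x))
  where
  shift : ∀ y → (toℕ (predFin y) ≤ᵇ i) ≡ (toℕ y ≤ᵇ suc i)
  shift zero = refl
  shift (suc zero) = refl
  shift (suc (suc y)) = refl

multichain : ∀ {d n} → (Fin d → Fin (suc n)) → Vec (Subset d) n
multichain {n = zero} f = []
multichain {n = suc n} f = level f 0 ∷ multichain (predFin ∘ f)

rank : ∀ {d n} → Vec (Subset d) n → Fin d → Fin (suc n)
rank [] x = zero
rank (S ∷ m) x = if lookup S x then zero else suc (rank m x)

IsChain : ∀ {d n} → Vec (Subset d) n → Set
IsChain m = Linked _⊆_ (toList m)

module _ {d : ℕ} where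

  multichain-cong : ∀ {n} {f g : Fin d → Fin (suc n)} → (∀ x → f x ≡ g x) →
    multichain f ≡ multichain g
  multichain-cong {zero} f≗g = refl
  multichain-cong {suc n} f≗g = cong₂ _∷_ (level-cong f≗g 0) (multichain-cong (cong predFin ∘ f≗g))

  rank-multichain : ∀ {n} (f : Fin d → Fin (suc n)) x → rank (multichain f) x ≡ f x
  rank-multichain {zero} f x with f x
  ... | zero = refl
  rank-multichain {suc n} f x =
    trans (cong (if_then zero else suc (rank (multichain (predFin ∘ f)) x))
                (lookup∘tabulate (λ y → toℕ (f y) ≤ᵇ 0) x))
          (unshift (f x) (rank-multichain (predFin ∘ f) x))
    where
    unshift : ∀ {r} y → r ≡ predFin y → (if toℕ y ≤ᵇ 0 then zero else suc r) ≡ y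
    unshift zero _ = refl
    unshift (suc y) refl = refl

  multichain-isChain : ∀ {n} (f : Fin d → Fin (suc n)) → IsChain (multichain f)
  multichain-isChain {zero} f = []
  multichain-isChain {suc zero} f = [-]
  multichain-isChain {suc (suc n)} f =
    subst (level f 0 ⊆_) (sym (level-predFin f 0)) (level-mono f z≤n)
    ∷ multichain-isChain (predFin ∘ f)

  level-rank-head : ∀ {n} S (m : Vec (Subset d) n) → level (rank (S ∷ m)) 0 ≡ S
  level-rank-head S m = trans (tabulate-cong head) (tabulate∘lookup S)
    where
    head : ∀ x → (toℕ (rank (S ∷ m) x) ≤ᵇ 0) ≡ lookup S x
    head x with lookup S x
    ... | true = refl
    ... | false = refl

  predFin-rank : ∀ {n} S (m : Vec (Subset d) n) → IsChain (S ∷ m) →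
    ∀ x → predFin (rank (S ∷ m) x) ≡ rank m x
  predFin-rank S m c x with lookup S x in x∈S
  ... | false = refl
  predFin-rank S [] c x | true = refl
  predFin-rank S (U ∷ m) (S⊆U ∷ _) x | true
    rewrite Equivalence.to ∈ₛ⇔lookup (S⊆U (Equivalence.from ∈ₛ⇔lookup x∈S)) = refl

  multichain-rank : ∀ {n} (m : Vec (Subset d) n) → IsChain m → multichain (rank m) ≡ m
  multichain-rank [] _ = refl
  multichain-rank (S ∷ m) c = cong₂ _∷_ (level-rank-head S m)
    (trans (multichain-cong (predFin-rank S m c)) (multichain-rank m (Linked.tail c)))

  ∈-multichain⁻ : ∀ {n} (f : Fin d → Fin (suc n)) {S} → S ∈ toList (multichain f) →
    ∃[ i ] i < n × S ≡ level f i
  ∈-multichain⁻ {suc n} f (here refl) = 0 , s≤s z≤n , refl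
  ∈-multichain⁻ {suc n} f (there S∈) with i , i<n , refl ← ∈-multichain⁻ (predFin ∘ f) S∈ =
    suc i , s≤s i<n , level-predFin f i

  level∈multichain : ∀ {n} (f : Fin d → Fin (suc n)) {i} → i < n → level f i ∈ toList (multichain f)
  level∈multichain {suc n} f {zero} _ = here refl
  level∈multichain {suc n} f {suc i} (s≤s i<n) =
    there (subst (_∈ toList (multichain (predFin ∘ f))) (level-predFin f i)
                 (level∈multichain (predFin ∘ f) i<n))

module _ {d n : ℕ} where

  Comparable : Vec (Subset d) n → Set
  Comparable m = ∀ {S U} → S ∈ toList m → U ∈ toList m → S ⊆ U ⊎ U ⊆ S

  ¬inI⇒comparable : ∀ m → ¬ T (inI m) → Comparable m
  ¬inI⇒comparable m ¬inI {S} {U} S∈m U∈m with T? (comparableB S U)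
  ... | yes S~U = Equivalence.to (comparableB⇔ S U) S~U
  ... | no S≁U = contradiction
    (Any⇒anyB _ (lose S∈m (Any⇒anyB _ (lose U∈m (Equivalence.from T-not⇔¬T S≁U))))) ¬inI

  comparable⇒¬inI : ∀ m → Comparable m → ¬ T (inI m)
  comparable⇒¬inI m cmp inI-m
    with S , S∈m , h ← find (anyB⇒Any _ (toList m) inI-m)
    with U , U∈m , S≁U ← find (anyB⇒Any _ (toList m) h)
    = Equivalence.to T-not⇔¬T S≁U (Equivalence.from (comparableB⇔ S U) (cmp S∈m U∈m))

  multichain-¬inI : ∀ (f : Fin d → Fin (suc n)) → ¬ T (inI (multichain f))
  multichain-¬inI f = comparable⇒¬inI (multichain f) λ S∈ U∈ →
    let i , _ , S≡ = ∈-multichain⁻ f S∈; j , _ , U≡ = ∈-multichain⁻ f U∈ in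
    subst₂ (λ S U → S ⊆ U ⊎ U ⊆ S) (sym S≡) (sym U≡)
      (Sum.map (level-mono f) (level-mono f) (≤-total i j))

standard⇒isChain : ∀ {d n} (m : Vec (Subset d) n) → T (sortedB m) → ¬ T (inI m) → IsChain m
standard⇒isChain [] _ _ = []
standard⇒isChain (S ∷ []) _ _ = [-]
standard⇒isChain (S ∷ U ∷ m) sorted ¬inI = S⊆U ∷ standard⇒isChain (U ∷ m) sorted′ ¬inI′
  where
  S≤U = proj₁ (Equivalence.to T-∧ sorted)
  sorted′ = proj₂ (Equivalence.to (T-∧ {lexLeq S U}) sorted)
  S⊆U : S ⊆ U
  S⊆U with ¬inI⇒comparable (S ∷ U ∷ m) ¬inI (here refl) (there (here refl))
  ... | inj₁ S⊆U = S⊆U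
  ... | inj₂ U⊆S = ⊆-reflexive (lexLeq-antisym S U S≤U U⊆S)
  ¬inI′ : ¬ T (inI (U ∷ m))
  ¬inI′ = comparable⇒¬inI (U ∷ m) λ S∈ U∈ →
    ¬inI⇒comparable (S ∷ U ∷ m) ¬inI (there S∈) (there U∈)

isChain⇒sorted : ∀ {d n} (m : Vec (Subset d) n) → IsChain m → T (sortedB m)
isChain⇒sorted [] _ = _
isChain⇒sorted (S ∷ []) _ = _
isChain⇒sorted (S ∷ U ∷ m) (S⊆U ∷ c) =
  Equivalence.from T-∧ (⊆⇒lexLeq S U S⊆U , isChain⇒sorted (U ∷ m) c)

Proper : ∀ {d} {A : Set} → SimpleGraph d → (Fin d → A) → Set
Proper G c = ∀ {x y} → T (adj G x y) → c x ≢ c y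

module _ {d : ℕ} where

  properB⇔Proper : ∀ {m} (G : SimpleGraph d) (φ : Vec (Fin m) d) →
    T (properB G φ) ⇔ Proper G (lookup φ)
  properB⇔Proper G φ = mk⇔
    (λ h {x} {y} xy φx≡φy → Equivalence.to T-not⇔¬T
      (Equivalence.to T-not-∨⇔ (Equivalence.to (allB²-allFin⇔ p) h x y) xy)
      (Equivalence.from (finEq⇔≡ _ _) φx≡φy))
    (λ proper → Equivalence.from (allB²-allFin⇔ p) λ x y →
      Equivalence.from T-not-∨⇔ λ xy →
      Equivalence.from T-not⇔¬T (proper xy ∘ Equivalence.to (finEq⇔≡ _ _)))
    where
    p : Fin d → Fin d → Bool
    p x y = not (adj G x y) ∨ not (finEq (lookup φ x) (lookup φ y))

  injectiveB⇔Injective : (π : Vec (Fin d) d) → T (injectiveB π) ⇔ Injective _≡_ _≡_ (lookup π)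
  injectiveB⇔Injective π = mk⇔
    (λ h {i} {j} πi≡πj → Equivalence.to (finEq⇔≡ i j)
      (Equivalence.to T-∨-not⇔ (Equivalence.to (allB²-allFin⇔ p) h i j)
        (Equivalence.from (finEq⇔≡ _ _) πi≡πj)))
    (λ inj → Equivalence.from (allB²-allFin⇔ p) λ i j →
      Equivalence.from T-∨-not⇔ (Equivalence.from (finEq⇔≡ i j) ∘ inj ∘ Equivalence.to (finEq⇔≡ _ _)))
    where
    p : Fin d → Fin d → Bool
    p i j = finEq i j ∨ not (finEq (lookup π i) (lookup π j))

  ∈-perms⇔ : ∀ π → π ∈ perms d ⇔ Injective _≡_ _≡_ (lookup π)
  ∈-perms⇔ π = mk⇔
    (Equivalence.to (injectiveB⇔Injective π) ∘ proj₂ ∘ ∈-filterB⁻ injectiveB (allVecs (allFin d) d))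
    (∈-filterB⁺ injectiveB (∈-allVecs (allFin d) ∈-allFin π)
      ∘ Equivalence.from (injectiveB⇔Injective π))

  inKG⇔ : ∀ {n} (G : SimpleGraph d) (m : Vec (Subset d) n) →
    T (inKG G m) ⇔ (∃[ π ] Injective _≡_ _≡_ (lookup π) × basicColoringChain G π ⊆ₗ toList m)
  inKG⇔ G m = mk⇔ to from
    where
    Divisor = ∃[ π ] Injective _≡_ _≡_ (lookup π) × basicColoringChain G π ⊆ₗ toList m
    to : T (inKG G m) → Divisor
    to h with π , π∈perms , divides ← find (anyB⇒Any _ (perms d) h) =
      π , Equivalence.to (∈-perms⇔ π) π∈perms ,
      Equivalence.to (occurs⇔∈ m)
        ∘ All.lookup (allB⇒All (λ S → occurs S m) (basicColoringChain G π) divides)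
    from : Divisor → T (inKG G m)
    from (π , inj , divides) = Any⇒anyB _ (lose (Equivalence.from (∈-perms⇔ π) inj)
      (All⇒allB _ (All.tabulate (Equivalence.from (occurs⇔∈ m) ∘ divides))))

data Path {A : Set} (E : A → A → Set) : A → ℕ → Set where
  start : ∀ a → Path E a 0
  _▷_   : ∀ {a b r} → Path E a r → E a b → Path E b (suc r)

Path-map : ∀ {A B : Set} {E : A → A → Set} {E′ : B → B → Set} (g : A → B) →
  (∀ {a b} → E a b → E′ (g a) (g b)) → ∀ {a r} → Path E a r → Path E′ (g a) r
Path-map g g-edge (start a) = start (g a)
Path-map g g-edge (p ▷ e) = Path-map g g-edge p ▷ g-edge e

module _ {d : ℕ} where

  consecAdj⇔Linked : ∀ (R : Fin d → Fin d → Bool) ps →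
    T (consecAdj R ps) ⇔ Linked (λ i j → T (R i j)) ps
  consecAdj⇔Linked R ps = mk⇔ (to ps) (from ps)
    where
    to : ∀ ps → T (consecAdj R ps) → Linked (λ i j → T (R i j)) ps
    to [] _ = []
    to (x ∷ []) _ = [-]
    to (x ∷ y ∷ ps) h = let Rxy , h′ = Equivalence.to T-∧ h in Rxy ∷ to (y ∷ ps) h′
    from : ∀ ps → Linked (λ i j → T (R i j)) ps → T (consecAdj R ps)
    from [] _ = _
    from (x ∷ []) _ = _
    from (x ∷ y ∷ ps) (Rxy ∷ l) = Equivalence.from T-∧ (Rxy , from (y ∷ ps) l)

  lastIs-∷ʳ : ∀ (ps : List (Fin d)) j → T (lastIs (ps ++ [ j ]) j)
  lastIs-∷ʳ [] j = Equivalence.from (finEq⇔≡ j j) refl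
  lastIs-∷ʳ (x ∷ []) j = Equivalence.from (finEq⇔≡ j j) refl
  lastIs-∷ʳ (x ∷ y ∷ ps) j = lastIs-∷ʳ (y ∷ ps) j

  Linked-∷ʳ : ∀ {E : Fin d → Fin d → Set} {i j} ps →
    Linked E ps → T (lastIs ps i) → E i j → Linked E (ps ++ [ j ])
  Linked-∷ʳ {i = i} (x ∷ []) [-] last e with refl ← Equivalence.to (finEq⇔≡ x i) last = e ∷ [-]
  Linked-∷ʳ (x ∷ y ∷ ps) (e′ ∷ l) last e = e′ ∷ Linked-∷ʳ (y ∷ ps) l last e

  path⇒linked : ∀ {E : Fin d → Fin d → Set} {k r} → Path E k r →
    ∃[ ps ] Linked E ps × T (lastIs ps k) × length ps ≡ suc r
  path⇒linked (start k) = [ k ] , [-] , Equivalence.from (finEq⇔≡ k k) refl , refl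
  path⇒linked {r = suc r} (_▷_ {b = j} p e) with ps , l , last , len ← path⇒linked p =
    ps ++ [ j ] , Linked-∷ʳ ps l last e , lastIs-∷ʳ ps j ,
    trans (length-++-comm ps [ j ]) (cong suc len)

  linked⇒path : ∀ {E : Fin d → Fin d → Set} {k x r} xs → Path E x r → Linked E (x ∷ xs) →
    T (lastIs (x ∷ xs) k) → Path E k (r + length xs)
  linked⇒path {k = k} {x} {r} [] p [-] last with refl ← Equivalence.to (finEq⇔≡ x k) last =
    subst (Path _ k) (sym (+-identityʳ r)) p
  linked⇒path {k = k} {r = r} (y ∷ xs) p (e ∷ l) last =
    subst (Path _ k) (sym (+-suc r (length xs))) (linked⇒path xs (p ▷ e) l last)

  positions-∷ : ∀ b (s : Vec Bool d) →
    positions (b ∷ s) ≡ (if b then zero ∷ map suc (positions s) else map suc (positions s))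
  positions-∷ b s = cong (λ ps → if b then zero ∷ ps else ps)
    (trans (cong (filterB (lookup (b ∷ s))) (sym (map-tabulate (λ i → i) suc)))
           (filterB-map (lookup (b ∷ s)) suc (allFin d)))

  Linked-map-suc : ∀ {l : List (Fin d)} → Linked _<ᶠ_ l → Linked _<ᶠ_ (map suc l)
  Linked-map-suc = Linked-map⁺ ∘ Linked.map s<s

  Linked-map-suc⁻ : ∀ {l : List (Fin d)} → Linked _<ᶠ_ (map suc l) → Linked _<ᶠ_ l
  Linked-map-suc⁻ = Linked.map s<s⁻¹ ∘ Linked-map⁻

  Linked-zero∷ : ∀ {l : List (Fin d)} → Linked _<ᶠ_ l → Linked _<ᶠ_ (zero ∷ map suc l)
  Linked-zero∷ [] = [-]
  Linked-zero∷ l@[-] = z<s ∷ Linked-map-suc l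
  Linked-zero∷ l@(_ ∷ _) = z<s ∷ Linked-map-suc l

  above-zero : ∀ {x : Fin (suc d)} qs → Linked _<ᶠ_ (x ∷ qs) → ∃[ qs′ ] qs ≡ map suc qs′
  above-zero [] _ = [] , refl
  above-zero (suc y ∷ qs) (_ ∷ l) with qs′ , refl ← above-zero qs l = y ∷ qs′ , refl

positions-increasing : ∀ {d} (s : Vec Bool d) → Linked _<ᶠ_ (positions s)
positions-increasing [] = []
positions-increasing (b ∷ s) rewrite positions-∷ b s with b
... | true  = Linked-zero∷ (positions-increasing s)
... | false = Linked-map-suc (positions-increasing s)

positions-surjective : ∀ {d} (ps : List (Fin d)) → Linked _<ᶠ_ ps → ∃[ s ] positions s ≡ ps
positions-surjective {zero} [] _ = [] , refl
positions-surjective {suc d} [] _ with s , e ← positions-surjective {d} [] [] =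
  false ∷ s , trans (positions-∷ false s) (cong (map suc) e)
positions-surjective {suc d} (zero ∷ ps) l
  with qs , refl ← above-zero ps l
  with s , e ← positions-surjective qs (Linked-map-suc⁻ (Linked.tail l)) =
  true ∷ s , trans (positions-∷ true s) (cong (λ ps → zero ∷ map suc ps) e)
positions-surjective {suc d} (suc x ∷ ps) l
  with qs , refl ← above-zero ps l
  with s , e ← positions-surjective (x ∷ qs) (Linked-map-suc⁻ l) =
  false ∷ s , trans (positions-∷ false s) (cong (map suc) e)

PositionEdge : ∀ {d} → SimpleGraph d → Vec (Fin d) d → Fin d → Fin d → Set
PositionEdge G π i j = i <ᶠ j × T (adj G (lookup π i) (lookup π j))

module _ {d} (G : SimpleGraph d) (π : Vec (Fin d) d) where

  private
    adjπ : Fin d → Fin d → Bool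
    adjπ i j = adj G (lookup π i) (lookup π j)

    valid : Fin d → Vec Bool d → Bool
    valid k s = lastIs (positions s) k ∧ consecAdj adjπ (positions s)

    len : Vec Bool d → ℕ
    len s = length (positions s) ∸ 1

    candidates : Fin d → List (Vec Bool d)
    candidates k = filterB (valid k) (allSubsets d)

    valid⇒path : ∀ {k} s → T (valid k s) → Path (PositionEdge G π) k (len s)
    valid⇒path s v with positions s | positions-increasing s | v
    ... | x ∷ xs | increasing | v′ = let last , adjs = Equivalence.to T-∧ v′ in
      linked⇒path xs (start x)
        (Linked.zip (increasing , Equivalence.to (consecAdj⇔Linked adjπ (x ∷ xs)) adjs)) last

  ell-maximal : ∀ {k r} → Path (PositionEdge G π) k r → r ≤ ell G π k
  ell-maximal {k} p
    with ps , edges , last , len≡ ← path⇒linked p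
    with s , refl ← positions-surjective ps (Linked.map proj₁ edges) =
    subst (_≤ ell G π k) (cong (_∸ 1) len≡)
      (≤-foldr-⊔ (map len (candidates k)) (∈-map⁺ len (∈-filterB⁺ (valid k) (every-subset s) valid-s)))
    where
    valid-s = Equivalence.from T-∧
      (last , Equivalence.from (consecAdj⇔Linked adjπ _) (Linked.map proj₂ edges))

  ell-path : ∀ k → Path (PositionEdge G π) k (ell G π k)
  ell-path k with foldr-selective ⊔-sel 0 (map len (candidates k))
  ... | inj₁ ell≡0 = subst (Path _ k) (sym ell≡0) (start k)
  ... | inj₂ ell∈ with s , s∈ , ell≡ ← ∈-map⁻ len ell∈ =
    subst (Path _ k) (sym ell≡) (valid⇒path s (proj₂ (∈-filterB⁻ (valid k) (allSubsets d) s∈)))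

  ell-increasing : ∀ {i j} → PositionEdge G π i j → ell G π i < ell G π j
  ell-increasing e = ell-maximal (ell-path _ ▷ e)

module _ {d : ℕ} where

  cutChain : Subset d → List (Fin d × ℕ) → List (Subset d)
  cutChain acc ws = prefixUnions acc (dropLast (blocks ws))

  private
    blocks-nonempty : ∀ (y : Fin d × ℕ) rest → ∃[ b ] ∃[ bs ] blocks (y ∷ rest) ≡ b ∷ bs
    blocks-nonempty y [] = _ , _ , refl
    blocks-nonempty y (z ∷ rest) with blocks (z ∷ rest) | blocks-nonempty z rest
    ... | _ | b , bs , refl with cutB y z
    ...   | true  = _ , _ , refl
    ...   | false = _ , _ , refl

    prefixUnions-merge : ∀ (acc : Subset d) x b bs →
      prefixUnions acc (dropLast ((x ∷ b) ∷ bs)) ≡ prefixUnions (acc ∪ toSubset [ x ]) (dropLast (b ∷ bs))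
    prefixUnions-merge acc x b [] = refl
    prefixUnions-merge acc x b (_ ∷ _) rewrite ∪-identityʳ ⁅ x ⁆ | ∪-assoc acc ⁅ x ⁆ (toSubset b) = refl

  module _ {m} (acc : Subset d) (w : Fin (suc (suc m)) → Fin d × ℕ) where

    cutChain-cut : T (cutB (w zero) (w (suc zero))) →
      cutChain acc (List.tabulate w)
        ≡ acc ∪ toSubset [ proj₁ (w zero) ] ∷ cutChain (acc ∪ toSubset [ proj₁ (w zero) ]) (List.tabulate (w ∘ suc))
    cutChain-cut cut
      with blocks (List.tabulate (w ∘ suc)) | blocks-nonempty (w (suc zero)) (List.tabulate (λ i → w (suc (suc i))))
    ... | _ | b , bs , refl rewrite Equivalence.to T-≡ cut = refl

    cutChain-noCut : ¬ T (cutB (w zero) (w (suc zero))) →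
      cutChain acc (List.tabulate w) ≡ cutChain (acc ∪ toSubset [ proj₁ (w zero) ]) (List.tabulate (w ∘ suc))
    cutChain-noCut ¬cut
      with blocks (List.tabulate (w ∘ suc)) | blocks-nonempty (w (suc zero)) (List.tabulate (λ i → w (suc (suc i))))
    ... | _ | b , bs , refl rewrite Equivalence.to T-not-≡ (Equivalence.from T-not⇔¬T ¬cut) =
      prefixUnions-merge acc (proj₁ (w zero)) b bs

  prefixSet : ∀ {m} → Subset d → (Fin m → Fin d × ℕ) → Fin m → Subset d
  prefixSet acc w zero = acc ∪ toSubset [ proj₁ (w zero) ]
  prefixSet acc w (suc k) = prefixSet (acc ∪ toSubset [ proj₁ (w zero) ]) (w ∘ suc) k

  acc⊆prefixSet : ∀ {m} acc (w : Fin m → Fin d × ℕ) k → acc ⊆ prefixSet acc w k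
  acc⊆prefixSet acc w zero = p⊆p∪q _
  acc⊆prefixSet acc w (suc k) = ⊆-trans (p⊆p∪q _) (acc⊆prefixSet _ (w ∘ suc) k)

  ∈-prefixSet⁺ : ∀ {m} acc (w : Fin m → Fin d × ℕ) {i} k → i ≤ᶠ k → proj₁ (w i) ∈ₛ prefixSet acc w k
  ∈-prefixSet⁺ acc w {zero} zero _ = x∈p∪q⁺ (inj₂ (Equivalence.from (∈ₛ-toSubset⇔ [ _ ]) (here refl)))
  ∈-prefixSet⁺ acc w {zero} (suc k) _ =
    acc⊆prefixSet _ (w ∘ suc) k (x∈p∪q⁺ (inj₂ (Equivalence.from (∈ₛ-toSubset⇔ [ _ ]) (here refl))))
  ∈-prefixSet⁺ acc w {suc i} (suc k) (s≤s i≤k) = ∈-prefixSet⁺ _ (w ∘ suc) k i≤k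

  ∈-prefixSet⁻ : ∀ {m} acc (w : Fin m → Fin d × ℕ) k {x} → x ∈ₛ prefixSet acc w k →
    x ∈ₛ acc ⊎ ∃[ i ] i ≤ᶠ k × proj₁ (w i) ≡ x
  ∈-prefixSet⁻ acc w zero x∈ with x∈p∪q⁻ acc _ x∈
  ... | inj₁ x∈acc = inj₁ x∈acc
  ... | inj₂ x∈w₀ = inj₂ (zero , z≤n , sym (singleton⁻ (Equivalence.to (∈ₛ-toSubset⇔ [ _ ]) x∈w₀)))
  ∈-prefixSet⁻ acc w (suc k) x∈ with ∈-prefixSet⁻ _ (w ∘ suc) k x∈
  ... | inj₂ (i , i≤k , w[1+i]≡x) = inj₂ (suc i , s≤s i≤k , w[1+i]≡x)
  ... | inj₁ x∈acc′ with x∈p∪q⁻ acc _ x∈acc′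
  ...   | inj₁ x∈acc = inj₁ x∈acc
  ...   | inj₂ x∈w₀ = inj₂ (zero , z≤n , sym (singleton⁻ (Equivalence.to (∈ₛ-toSubset⇔ [ _ ]) x∈w₀)))

  prefixSet∈cutChain : ∀ {m} acc (w : Fin m → Fin d × ℕ) {k k′} → k ⋖ k′ → T (cutB (w k) (w k′)) →
    prefixSet acc w k ∈ cutChain acc (List.tabulate w)
  prefixSet∈cutChain {suc (suc m)} acc w {zero} {suc zero} _ cut =
    subst (prefixSet acc w zero ∈_) (sym (cutChain-cut acc w cut)) (here refl)
  prefixSet∈cutChain {suc (suc m)} acc w {suc k} {suc k′} k⋖k′ cut with T? (cutB (w zero) (w (suc zero)))
  ... | yes cut₀ = subst (prefixSet acc w (suc k) ∈_) (sym (cutChain-cut acc w cut₀))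
                     (there (prefixSet∈cutChain {suc m} _ (w ∘ suc) (suc-injective k⋖k′) cut))
  ... | no ¬cut₀ = subst (prefixSet acc w (suc k) ∈_) (sym (cutChain-noCut acc w ¬cut₀))
                     (prefixSet∈cutChain {suc m} _ (w ∘ suc) (suc-injective k⋖k′) cut)

  CutPrefix : ∀ {m} → Subset d → (Fin m → Fin d × ℕ) → Subset d → Set
  CutPrefix acc w S = ∃[ k ] ∃[ k′ ] k ⋖ k′ × T (cutB (w k) (w k′)) × S ≡ prefixSet acc w k

  private
    CutPrefix-suc : ∀ {m} acc (w : Fin (suc m) → Fin d × ℕ) {S} →
      CutPrefix (acc ∪ toSubset [ proj₁ (w zero) ]) (w ∘ suc) S → CutPrefix acc w S
    CutPrefix-suc acc w (k , k′ , k⋖k′ , cut , S≡) = suc k , suc k′ , cong suc k⋖k′ , cut , S≡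

  cutChain⇒prefixSet : ∀ {m} acc (w : Fin m → Fin d × ℕ) {S} →
    S ∈ cutChain acc (List.tabulate w) → CutPrefix acc w S
  cutChain⇒prefixSet {zero} acc w ()
  cutChain⇒prefixSet {suc zero} acc w ()
  cutChain⇒prefixSet {suc (suc m)} acc w {S} S∈ =
    split (T? (cutB (w zero) (w (suc zero)))) (cutChain⇒prefixSet _ (w ∘ suc))
    where
    acc′ = acc ∪ toSubset [ proj₁ (w zero) ]
    split : Dec (T (cutB (w zero) (w (suc zero)))) →
      (∀ {S′} → S′ ∈ cutChain acc′ (List.tabulate (w ∘ suc)) → CutPrefix acc′ (w ∘ suc) S′) →
      CutPrefix acc w S
    split (yes cut₀) ih =
      [ (λ S≡ → zero , suc zero , refl , cut₀ , S≡) , CutPrefix-suc acc w ∘ ih ]′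
      (Any.toSum (subst (S ∈_) (cutChain-cut acc w cut₀) S∈))
    split (no ¬cut₀) ih = CutPrefix-suc acc w (ih (subst (S ∈_) (cutChain-noCut acc w ¬cut₀) S∈))

module _ {d} (G : SimpleGraph d) (π : Vec (Fin d) d) where

  entry : Fin d → Fin d × ℕ
  entry k = lookup π k , ell G π k

  basicColoringChain≡cutChain : basicColoringChain G π ≡ cutChain ∅ (List.tabulate entry)
  basicColoringChain≡cutChain = cong (cutChain ∅) (zip-toList-map-allFin π (ell G π))

  ∈-prefixSet⇔ : ∀ k {x} → x ∈ₛ prefixSet ∅ entry k ⇔ (∃[ i ] i ≤ᶠ k × lookup π i ≡ x)
  ∈-prefixSet⇔ k = mk⇔
    ([ (λ x∈∅ → contradiction x∈∅ ∉⊥) , (λ found → found) ]′ ∘ ∈-prefixSet⁻ ∅ entry k)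
    (λ { (i , i≤k , refl) → ∈-prefixSet⁺ ∅ entry k i≤k })

  cut⇒prefixSet∈basicColoringChain : ∀ {k k′} → k ⋖ k′ → T (cutB (entry k) (entry k′)) →
    prefixSet ∅ entry k ∈ basicColoringChain G π
  cut⇒prefixSet∈basicColoringChain {k} k⋖k′ cut =
    subst (prefixSet ∅ entry k ∈_) (sym basicColoringChain≡cutChain) (prefixSet∈cutChain ∅ entry k⋖k′ cut)

  ∈basicColoringChain⇒cut : ∀ {S} → S ∈ basicColoringChain G π → CutPrefix ∅ entry S
  ∈basicColoringChain⇒cut {S} S∈ =
    cutChain⇒prefixSet ∅ entry (subst (S ∈_) basicColoringChain≡cutChain S∈)

cutB⇔lex : ∀ {d} (x y : Fin d × ℕ) →
  T (cutB x y) ⇔ (proj₂ x < proj₂ y ⊎ (proj₂ x ≡ proj₂ y × toℕ (proj₁ x) < toℕ (proj₁ y)))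
cutB⇔lex (a , l) (a′ , l′) = mk⇔ to from
  where
  to : _
  to h with Equivalence.to T-∨ h
  ... | inj₁ l<l′ = inj₁ (<ᵇ⇒< l l′ l<l′)
  ... | inj₂ h′ = let l≡l′ , a<a′ = Equivalence.to T-∧ h′ in
                  inj₂ (≡ᵇ⇒≡ l l′ l≡l′ , <ᵇ⇒< _ _ a<a′)
  from : _
  from (inj₁ l<l′) = Equivalence.from T-∨ (inj₁ (<⇒<ᵇ l<l′))
  from (inj₂ (l≡l′ , a<a′)) =
    Equivalence.from T-∨ (inj₂ (Equivalence.from T-∧ (≡⇒≡ᵇ l l′ l≡l′ , <⇒<ᵇ a<a′)))

¬cut⇒≥ : ∀ {d} (x y : Fin d × ℕ) → ¬ T (cutB x y) → proj₂ y ≤ proj₂ x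
¬cut⇒≥ x y ¬cut = ≮⇒≥ (¬cut ∘ Equivalence.from (cutB⇔lex x y) ∘ inj₁)

cutB-asym : ∀ {d} (x y : Fin d × ℕ) → T (cutB x y) → ¬ T (cutB y x)
cutB-asym x y xy yx with Equivalence.to (cutB⇔lex x y) xy | Equivalence.to (cutB⇔lex y x) yx
... | inj₁ lx<ly | inj₁ ly<lx = <-asym lx<ly ly<lx
... | inj₁ lx<ly | inj₂ (ly≡lx , _) = <-irrefl (sym ly≡lx) lx<ly
... | inj₂ (lx≡ly , _) | inj₁ ly<lx = <-irrefl (sym lx≡ly) ly<lx
... | inj₂ (_ , ax<ay) | inj₂ (_ , ay<ax) = <-asym ax<ay ay<ax

module _ {d m : ℕ} (w : Fin m → Fin d × ℕ) where

  CutBetween : Fin m → Fin m → Set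
  CutBetween i j = ∃[ k ] ∃[ k′ ] k ⋖ k′ × i ≤ᶠ k × k′ ≤ᶠ j × T (cutB (w k) (w k′))

  -- ℓ does not increase across a boundary that is not a cut.
  cutBetween⊎≥ : ∀ {i j} → i ≤ᶠ j → CutBetween i j ⊎ proj₂ (w j) ≤ proj₂ (w i)
  cutBetween⊎≥ {i} {j} i≤j = walk (toℕ j ∸ toℕ i) (sym (m+[n∸m]≡n i≤j))
    where
    walk : ∀ gap {j} → toℕ j ≡ toℕ i + gap → CutBetween i j ⊎ proj₂ (w j) ≤ proj₂ (w i)
    walk zero {j} j≡i with refl ← toℕ-injective (trans j≡i (+-identityʳ (toℕ i))) = inj₂ ≤-refl
    walk (suc gap) {j} j≡i+1+gap = step (fromℕ< k<m) (toℕ-fromℕ< k<m)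
      where
      j≡1+i+gap : toℕ j ≡ suc (toℕ i + gap)
      j≡1+i+gap = trans j≡i+1+gap (+-suc (toℕ i) gap)
      k<m : toℕ i + gap < m
      k<m = ≤-<-trans (n≤1+n _) (subst (_< m) j≡1+i+gap (toℕ<n j))
      step : ∀ k → toℕ k ≡ toℕ i + gap → CutBetween i j ⊎ proj₂ (w j) ≤ proj₂ (w i)
      step k k≡i+gap = extend (walk gap k≡i+gap) (T? (cutB (w k) (w j)))
        where
        k⋖j : k ⋖ j
        k⋖j = trans j≡1+i+gap (cong suc (sym k≡i+gap))
        extend : CutBetween i k ⊎ proj₂ (w k) ≤ proj₂ (w i) → Dec (T (cutB (w k) (w j))) →
          CutBetween i j ⊎ proj₂ (w j) ≤ proj₂ (w i)
        extend (inj₁ (a , b , a⋖b , i≤a , b≤k , cut)) _ =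
          inj₁ (a , b , a⋖b , i≤a , ≤-trans b≤k (subst (toℕ k ≤_) (sym k⋖j) (n≤1+n _)) , cut)
        extend (inj₂ _) (yes cut) =
          inj₁ (k , j , k⋖j , subst (toℕ i ≤_) (sym k≡i+gap) (m≤m+n _ _) , ≤-refl , cut)
        extend (inj₂ ℓk≤ℓi) (no ¬cut) = inj₂ (≤-trans (¬cut⇒≥ (w k) (w j) ¬cut) ℓk≤ℓi)

module _ {d n : ℕ} (G : SimpleGraph d) (f : Fin d → Fin (suc n)) where

  -- A cut between the two ends of an edge puts them on different sides of a level set of f.
  divides⇒separates : ∀ {π} → Injective _≡_ _≡_ (lookup π) →
    basicColoringChain G π ⊆ₗ toList (multichain f) →
    ∀ {i j} → PositionEdge G π i j → f (lookup π i) ≢ f (lookup π j)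
  divides⇒separates {π} π-inj divides {i} {j} (i<j , ij) fπi≡fπj
    with cutBetween⊎≥ (entry G π) (<⇒≤ i<j)
  ... | inj₂ ℓj≤ℓi = <⇒≱ (ell-increasing G π (i<j , ij)) ℓj≤ℓi
  ... | inj₁ (k , k′ , k⋖k′ , i≤k , k′≤j , cut)
    with t , _ , S≡level ← ∈-multichain⁻ f (divides (cut⇒prefixSet∈basicColoringChain G π k⋖k′ cut)) =
    πj∉S (subst (lookup π j ∈ₛ_) (sym S≡level) πj∈level)
    where
    S = prefixSet ∅ (entry G π) k
    πi∈S : lookup π i ∈ₛ S
    πi∈S = Equivalence.from (∈-prefixSet⇔ G π k) (i , i≤k , refl)
    πj∈level : lookup π j ∈ₛ level f t
    πj∈level = Equivalence.from (∈-level⇔ f)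
      (subst (λ c → toℕ c ≤ t) fπi≡fπj (Equivalence.to (∈-level⇔ f) (subst (lookup π i ∈ₛ_) S≡level πi∈S)))
    πj∉S : ¬ lookup π j ∈ₛ S
    πj∉S πj∈S
      with i′ , i′≤k , πi′≡πj ← Equivalence.to (∈-prefixSet⇔ G π k) πj∈S
      with refl ← π-inj πi′≡πj = 1+n≰n (subst (_≤ toℕ k) k⋖k′ (≤-trans k′≤j i′≤k))

  inKG⇒proper : T (inKG G (multichain f)) → Proper G f
  inKG⇒proper h {x} {y} xy fx≡fy
    with π , π-inj , divides ← Equivalence.to (inKG⇔ G (multichain f)) h
    with i , refl ← injective⇒surjective (lookup π) π-inj x
    with j , refl ← injective⇒surjective (lookup π) π-inj y
    with <-cmpᶠ i j
  ... | tri< i<j _ _ = divides⇒separates {π} π-inj divides (i<j , xy) fx≡fy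
  ... | tri≈ _ refl _ = subst T (irrefl G (lookup π i)) xy
  ... | tri> _ _ j<i =
    divides⇒separates {π} π-inj divides (j<i , subst T (SimpleGraph.sym G _ _) xy) (sym fx≡fy)

module ColourOrder {d n : ℕ} (G : SimpleGraph d) (f : Fin d → Fin (suc n)) where

  F : Fin d → ℕ
  F = toℕ ∘ f

  ColourEdge : Fin d → Fin d → Set
  ColourEdge u v = F u < F v × T (adj G u v)

  private
    heightWithin : ℕ → Fin d → ℕ
    viaEdge : ℕ → Fin d → Fin d → ℕ

    heightWithin zero v = 0
    heightWithin (suc t) v = foldr _⊔_ 0 (map (viaEdge t v) (allFin d))

    viaEdge t v u = if adj G u v ∧ (F u <ᵇ F v) then suc (heightWithin t u) else 0

    path-≤-heightWithin : ∀ {v r} t → Path ColourEdge v r → F v < t → r ≤ heightWithin t v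
    path-≤-heightWithin t (start v) _ = z≤n
    path-≤-heightWithin (suc t) (_▷_ {a = u} {b = v} p (Fu<Fv , uv)) (s≤s Fv≤t) =
      ≤-trans (s≤s (path-≤-heightWithin t p (<-≤-trans Fu<Fv Fv≤t)))
              (subst (_≤ heightWithin (suc t) v) through-u (≤-foldr-⊔ _ (∈-map⁺ (viaEdge t v) (∈-allFin u))))
      where
      through-u : viaEdge t v u ≡ suc (heightWithin t u)
      through-u = cong (if_then suc (heightWithin t u) else 0)
                       (Equivalence.to T-≡ (Equivalence.from T-∧ (uv , <⇒<ᵇ Fu<Fv)))

    heightWithin-path : ∀ t v → Path ColourEdge v (heightWithin t v)
    viaEdge-path : ∀ t v u → Path ColourEdge v (viaEdge t v u)

    heightWithin-path zero v = start v
    heightWithin-path (suc t) v with foldr-selective ⊔-sel 0 (map (viaEdge t v) (allFin d))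
    ... | inj₁ h≡0 = subst (Path ColourEdge v) (sym h≡0) (start v)
    ... | inj₂ h∈ with u , _ , h≡ ← ∈-map⁻ (viaEdge t v) h∈ =
      subst (Path ColourEdge v) (sym h≡) (viaEdge-path t v u)

    viaEdge-path t v u with adj G u v ∧ (F u <ᵇ F v) in colourEdge
    ... | true  = let uv , Fu<Fv = Equivalence.to T-∧ (Equivalence.from T-≡ colourEdge) in
                  heightWithin-path t u ▷ (<ᵇ⇒< _ _ Fu<Fv , uv)
    ... | false = start v

  -- Colours strictly increase along a path, so it has at most n edges.
  height : Fin d → ℕ
  height = heightWithin (suc n)

  height-maximal : ∀ {v r} → Path ColourEdge v r → r ≤ height v
  height-maximal {v} p = path-≤-heightWithin (suc n) p (toℕ<n (f v))

  height-path : ∀ v → Path ColourEdge v (height v)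
  height-path = heightWithin-path (suc n)

  -- By colour, and inside a colour class against the cut order,
  -- so that π has cuts only where the colour jumps.
  _≼_ : Fin d → Fin d → Bool
  u ≼ v = (F u <ᵇ F v) ∨ ((F u ≡ᵇ F v) ∧ not (cutB (u , height u) (v , height v)))

  ≼⇔ : ∀ u v → T (u ≼ v) ⇔ (F u < F v ⊎ (F u ≡ F v × ¬ T (cutB (u , height u) (v , height v))))
  ≼⇔ u v = mk⇔ to from
    where
    to : _
    to h with Equivalence.to T-∨ h
    ... | inj₁ lt = inj₁ (<ᵇ⇒< _ _ lt)
    ... | inj₂ h′ = let eq , ¬cut = Equivalence.to T-∧ h′ in
                    inj₂ (≡ᵇ⇒≡ _ _ eq , Equivalence.to T-not⇔¬T ¬cut)
    from : _
    from (inj₁ lt) = Equivalence.from T-∨ (inj₁ (<⇒<ᵇ lt))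
    from (inj₂ (eq , ¬cut)) =
      Equivalence.from T-∨ (inj₂ (Equivalence.from T-∧ (≡⇒≡ᵇ _ _ eq , Equivalence.from T-not⇔¬T ¬cut)))

  ≼-total : ∀ u v → ¬ T (u ≼ v) → T (v ≼ u)
  ≼-total u v u⋠v with <-cmp (F u) (F v)
  ... | tri< lt _ _ = contradiction (Equivalence.from (≼⇔ u v) (inj₁ lt)) u⋠v
  ... | tri> _ _ gt = Equivalence.from (≼⇔ v u) (inj₁ gt)
  ... | tri≈ _ eq _ with T? (cutB (u , height u) (v , height v))
  ...   | yes cut = Equivalence.from (≼⇔ v u) (inj₂ (sym eq , cutB-asym (u , height u) (v , height v) cut))
  ...   | no ¬cut = contradiction (Equivalence.from (≼⇔ u v) (inj₂ (eq , ¬cut))) u⋠v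

  open InsertionSort _≼_ ≼-total

  π : Vec (Fin d) d
  π = sort (tabulate (λ v → v))

  private
    π-↭ : toList π ↭ allFin d
    π-↭ = subst (toList π ↭_) (toList-tabulate (λ v → v)) (sort-↭ (tabulate (λ v → v)))

    π-sorted : Sorted π
    π-sorted = sort-sorted (tabulate (λ v → v))

  π-injective : Injective _≡_ _≡_ (lookup π)
  π-injective = lookup-injective π
    (Permutationₛ.Unique-resp-↭ (setoid (Fin d)) (↭⇒↭ₛ (↭-sym π-↭)) (Unique.allFin⁺ d))

  π-surjective : ∀ v → ∃[ i ] lookup π i ≡ v
  π-surjective v = ∈-toList⇒lookup π (∈-resp-↭ (↭-sym π-↭) (∈-allFin v))

  π-consecutive : ∀ {k k′} → k ⋖ k′ → T (lookup π k ≼ lookup π k′)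
  π-consecutive = Linked-lookup-⋖ π π-sorted

  π⁻¹ : Fin d → Fin d
  π⁻¹ v = proj₁ (π-surjective v)

  π∘π⁻¹ : ∀ v → lookup π (π⁻¹ v) ≡ v
  π∘π⁻¹ v = proj₂ (π-surjective v)

  colour-mono : ∀ {i j} → i ≤ᶠ j → F (lookup π i) ≤ F (lookup π j)
  colour-mono = Linked-lookup-mono F ≼⇒≤ π π-sorted
    where
    ≼⇒≤ : ∀ {u v} → T (u ≼ v) → F u ≤ F v
    ≼⇒≤ {u} {v} = [ <⇒≤ , ≤-reflexive ∘ proj₁ ]′ ∘ Equivalence.to (≼⇔ u v)

  prefixSet≡level : ∀ {k k′} → k ⋖ k′ → F (lookup π k) < F (lookup π k′) →
    prefixSet ∅ (entry G π) k ≡ level f (F (lookup π k))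
  prefixSet≡level {k} {k′} k⋖k′ jump = ⊆-antisym
    (λ x∈S → let i , i≤k , πi≡x = Equivalence.to (∈-prefixSet⇔ G π k) x∈S in
      Equivalence.from (∈-level⇔ f) (subst (λ x → F x ≤ F (lookup π k)) πi≡x (colour-mono i≤k)))
    (λ x∈level → let i , πi≡x = π-surjective _ in
      Equivalence.from (∈-prefixSet⇔ G π k) (i , i≤k x∈level πi≡x , πi≡x))
    where
    i≤k : ∀ {x i} → x ∈ₛ level f (F (lookup π k)) → lookup π i ≡ x → i ≤ᶠ k
    i≤k x∈level refl = ≮⇒≥ λ k<i → <⇒≱ jump
      (≤-trans (colour-mono (subst (_≤ _) (sym k⋖k′) k<i)) (Equivalence.to (∈-level⇔ f) x∈level))

module _ {d n : ℕ} (G : SimpleGraph d) (f : Fin d → Fin (suc n)) (proper : Proper G f) where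

  open ColourOrder G f

  positionEdge⇒colourEdge : ∀ {i j} → PositionEdge G π i j → ColourEdge (lookup π i) (lookup π j)
  positionEdge⇒colourEdge (i<j , ij) = ≤∧≢⇒< (colour-mono (<⇒≤ i<j)) (proper ij ∘ toℕ-injective) , ij

  colourEdge⇒positionEdge : ∀ {u v} → ColourEdge u v → PositionEdge G π (π⁻¹ u) (π⁻¹ v)
  colourEdge⇒positionEdge {u} {v} (Fu<Fv , uv) =
    π⁻¹u<π⁻¹v , subst₂ (λ a b → T (adj G a b)) (sym (π∘π⁻¹ u)) (sym (π∘π⁻¹ v)) uv
    where
    π⁻¹u<π⁻¹v : π⁻¹ u <ᶠ π⁻¹ v
    π⁻¹u<π⁻¹v = ≰⇒> λ v≤u → <⇒≱ Fu<Fv (subst₂ (λ a b → F a ≤ F b) (π∘π⁻¹ v) (π∘π⁻¹ u) (colour-mono v≤u))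

  ell≡height : ∀ k → ell G π k ≡ height (lookup π k)
  ell≡height k = ≤-antisym
    (height-maximal (Path-map (lookup π) positionEdge⇒colourEdge (ell-path G π k)))
    (subst (λ i → height (lookup π k) ≤ ell G π i) (π-injective (π∘π⁻¹ (lookup π k)))
      (ell-maximal G π (Path-map π⁻¹ colourEdge⇒positionEdge (height-path (lookup π k)))))

  cut⇒colour-jump : ∀ {k k′} → k ⋖ k′ → T (cutB (entry G π k) (entry G π k′)) →
    F (lookup π k) < F (lookup π k′)
  cut⇒colour-jump {k} {k′} k⋖k′ cut =
    ≤∧≢⇒< (colour-mono (subst (toℕ k ≤_) (sym k⋖k′) (n≤1+n _))) same-colour⇒no-cut
    where
    same-colour⇒no-cut : F (lookup π k) ≢ F (lookup π k′)
    same-colour⇒no-cut eq with Equivalence.to (≼⇔ _ _) (π-consecutive k⋖k′)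
    ... | inj₁ lt = <-irrefl eq lt
    ... | inj₂ (_ , ¬cut) =
      ¬cut (subst₂ (λ a b → T (cutB (lookup π k , a) (lookup π k′ , b))) (ell≡height k) (ell≡height k′) cut)

  basicColoringChain⊆multichain : basicColoringChain G π ⊆ₗ toList (multichain f)
  basicColoringChain⊆multichain S∈ with k , k′ , k⋖k′ , cut , refl ← ∈basicColoringChain⇒cut G π S∈ =
    subst (_∈ toList (multichain f)) (sym (prefixSet≡level k⋖k′ jump))
      (level∈multichain f (<-≤-trans jump (s≤s⁻¹ (toℕ<n (f (lookup π k′))))))
    where jump = cut⇒colour-jump k⋖k′ cut

  proper⇒inKG : T (inKG G (multichain f))
  proper⇒inKG = Equivalence.from (inKG⇔ G (multichain f)) (π , π-injective , basicColoringChain⊆multichain)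

multichain∈K⇔proper : ∀ {d n} (G : SimpleGraph d) (f : Fin d → Fin (suc n)) →
  T (inKG G (multichain f)) ⇔ Proper G f
multichain∈K⇔proper G f = mk⇔ (inKG⇒proper G f) (proper⇒inKG G f)

module _ {d : ℕ} (G : SimpleGraph d) (n : ℕ) where

  private
    standard : Vec (Subset d) n → Bool
    standard m = not (inI m) ∧ not (inKG G m)

    maps : List (Vec (Fin (suc n)) d)
    maps = allVecs (allFin (suc n)) d

    monomial : Vec (Fin (suc n)) d → Vec (Subset d) n
    monomial φ = multichain (lookup φ)

    monomial-injective : Injective _≡_ _≡_ monomial
    monomial-injective {φ} {ψ} same = begin
      φ                     ≡⟨ tabulate∘lookup φ ⟨
      tabulate (lookup φ)   ≡⟨ tabulate-cong (λ x → begin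
                                 lookup φ x                     ≡⟨ rank-multichain (lookup φ) x ⟨
                                 rank (multichain (lookup φ)) x ≡⟨ cong (λ m → rank m x) same ⟩
                                 rank (multichain (lookup ψ)) x ≡⟨ rank-multichain (lookup ψ) x ⟩
                                 lookup ψ x                     ∎) ⟩
      tabulate (lookup ψ)   ≡⟨ tabulate∘lookup ψ ⟩
      ψ                     ∎
      where open ≡-Reasoning

    monomial∈K⇒properB : ∀ φ → T (inKG G (monomial φ)) → T (properB G φ)
    monomial∈K⇒properB φ =
      Equivalence.from (properB⇔Proper G φ) ∘ Equivalence.to (multichain∈K⇔proper G (lookup φ))

    properB⇒monomial∈K : ∀ φ → T (properB G φ) → T (inKG G (monomial φ))
    properB⇒monomial∈K φ =
      Equivalence.from (multichain∈K⇔proper G (lookup φ)) ∘ Equivalence.to (properB⇔Proper G φ)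

    improper⇒standard : ∀ {φ} → φ ∈ maps → T (not (properB G φ)) →
      monomial φ ∈ monomials d n × T (standard (monomial φ))
    improper⇒standard {φ} _ improper =
      ∈-filterB⁺ sortedB (∈-allVecs (allSubsets d) every-subset (monomial φ))
        (isChain⇒sorted _ (multichain-isChain (lookup φ))) ,
      Equivalence.from T-∧
        ( Equivalence.from T-not⇔¬T (multichain-¬inI (lookup φ))
        , Equivalence.from T-not⇔¬T (Equivalence.to T-not⇔¬T improper ∘ monomial∈K⇒properB φ) )

    standard⇒improper : ∀ {m} → m ∈ monomials d n → T (standard m) →
      ∃[ φ ] φ ∈ maps × T (not (properB G φ)) × monomial φ ≡ m
    standard⇒improper {m} m∈ standard-m =
      φ , ∈-allVecs (allFin (suc n)) ∈-allFin φ ,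
      Equivalence.from T-not⇔¬T (¬inKG ∘ subst (T ∘ inKG G) monomial-φ≡m ∘ properB⇒monomial∈K φ) ,
      monomial-φ≡m
      where
      ¬inI = Equivalence.to T-not⇔¬T (proj₁ (Equivalence.to T-∧ standard-m))
      ¬inKG = Equivalence.to T-not⇔¬T (proj₂ (Equivalence.to (T-∧ {not (inI m)}) standard-m))
      φ = tabulate (rank m)
      sorted = proj₂ (∈-filterB⁻ sortedB (allVecs (allSubsets d) n) m∈)
      monomial-φ≡m : monomial φ ≡ m
      monomial-φ≡m = trans (multichain-cong (lookup∘tabulate (rank m)))
                           (multichain-rank m (standard⇒isChain m sorted ¬inI))

  hilbertFn≡#improper : hilbertFn G n ≡ countB (not ∘ properB G) maps
  hilbertFn≡#improper = sym (countB-bijection standard (not ∘ properB G)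
    (filterB-unique sortedB (allVecs-unique _ (allVecs-unique _ booleans-unique d) n))
    (allVecs-unique _ (Unique.allFin⁺ (suc n)) d)
    monomial monomial-injective improper⇒standard standard⇒improper)

  chromatic+hilbertFn : chromatic G (suc n) + hilbertFn G n ≡ suc n ^ d
  chromatic+hilbertFn = begin
    chromatic G (suc n) + hilbertFn G n
      ≡⟨ cong (λ h → chromatic G (suc n) + h) hilbertFn≡#improper ⟩
    countB (properB G) maps + countB (not ∘ properB G) maps  ≡⟨ countB+countB-not (properB G) maps ⟩
    length maps                                              ≡⟨ length-allVecs (allFin (suc n)) d ⟩
    length (allFin (suc n)) ^ d                              ≡⟨ cong (_^ d) (length-tabulate (λ i → i)) ⟩
    suc n ^ d                                                ∎
    where open ≡-Reasoning

theorem3p3 : (d : ℕ) → 1 ≤ d → (G : SimpleGraph d) →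
    (tailChrom G 0 ≡ + 0) × ((n : ℕ) → tailChrom G (suc n) ≡ + hilbertFn G n)
theorem3p3 (suc d) _ G = refl , tail
  where
  tail : (n : ℕ) → tailChrom G (suc n) ≡ + hilbertFn G n
  tail n = begin
    + (suc n ^ suc d) - + χ   ≡⟨ cong (λ m → + m - + χ) (chromatic+hilbertFn G n) ⟨
    + (χ + h) - + χ           ≡⟨ m-n≡m⊖n (χ + h) χ ⟩
    (χ + h) ⊖ χ               ≡⟨ ⊖-≥ (m≤m+n χ h) ⟩
    + (χ + h ∸ χ)             ≡⟨ cong +_ (m+n∸m≡n χ h) ⟩
    + h                       ∎
    where
    open ≡-Reasoning
    χ = chromatic G (suc n)
    h = hilbertFn G n
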